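{- Let $\mathfrak{C}$ be a class of graphs closed under the operation of attaching pendant edges (i.e. if $G\in\mathfrak{C}$ and $G'$ is obtained from $G$ by adding a new vertex joined by a single edge to a vertex of $G$, then $G'\in\mathfrak{C}$), and let $f$ be a real-valued function on the positive integers. If $W(G')\leq f(|V(G')|)$ holds for every graph $G'\in\mathfrak{C}\cap\mathfrak{N}$, then for every graph $G\in\mathfrak{C}$ we have $W_{def}(G)\leq f\left(|V(G)|+def(G)\right)$.
   Context: All graphs are finite, undirected, without loops or multiple edges. A proper $t$-edge-coloring of $G$ is a map $\alpha:E(G)\to\{1,\ldots,t\}$ such that all $t$ colors are used and adjacent edges receive different colors. The spectrum $S(v,\alpha)$ of a vertex $v$ is the set of colors on edges incident to $v$. For a finite set $A$ of integers, $def(A)=\max A-\min A-|A|+1$ (the number of integers strictly between $\min A$ and $\max A$ not in $A$; $def(\emptyset)=0$). Define $def(v,\alpha)=def(S(v,\alpha))$, $def(G,\alpha)=\sum_{v\in V(G)}def(v,\alpha)$, and $def(G)=\min_\alpha def(G,\alpha)$ over all proper edge-colorings $\alpha$ of $G$. $W_{def}(G)$ denotes the largest $t$ such that $G$ has a proper $t$-edge-coloring $\alpha$ with $def(G,\alpha)=def(G)$. An interval $t$-coloring is a proper $t$-edge-coloring with every spectrum an interval of integers; $\mathfrak{N}$ is the class of graphs admitting an interval $t$-coloring for some $t$, and for $G\in\mathfrak{N}$, $W(G)$ is the largest $t$ for which $G$ has an interval $t$-coloring. -}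

module Defs where

open import Data.Nat using (ℕ; zero; suc; _+_; _∸_; _≤_; _⊓_; _⊔_)
import Data.Nat as ℕ
open import Data.Bool using (Bool; true; false; T)
open import Data.Fin using (Fin; zero; suc)
import Data.Fin as Fin
open import Data.List using (List; []; _∷_; map; filter; length; foldr; upTo)
open import Data.Nat.ListAction using (sum)
open import Data.List.Membership.DecPropositional ℕ._≟_ using (_∈?_)
open import Data.Product using (Σ; ∃; _×_; _,_)
open import Relation.Nullary using (¬_; ¬?)
open import Relation.Nullary.Decidable using (T?; ⌊_⌋)
open import Relation.Binary.PropositionalEquality using (_≡_; _≢_; refl; sym)

record Graph : Set where
  field
    n          : ℕ
    adj        : Fin n → Fin n → Bool
    adj-sym    : ∀ u v → adj u v ≡ adj v u
    adj-irrefl : ∀ v → adj v v ≡ false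
open Graph public

∣V∣ : Graph → ℕ
∣V∣ = Graph.n

-- Attaching a pendant edge: a new vertex (index zero; old vertex i
-- becomes suc i) joined by a single edge to the old vertex v.

private
  eqb : ∀ {k} → Fin k → Fin k → Bool
  eqb i j = ⌊ i Fin.≟ j ⌋

  eqb-sym : ∀ {k} (i j : Fin k) → eqb i j ≡ eqb j i
  eqb-sym i j with i Fin.≟ j | j Fin.≟ i
  ... | Relation.Nullary.yes _ | Relation.Nullary.yes _ = refl
  ... | Relation.Nullary.no _  | Relation.Nullary.no _  = refl
  ... | Relation.Nullary.yes p | Relation.Nullary.no q  = Data.Empty.⊥-elim (q (sym p))
    where import Data.Empty
  ... | Relation.Nullary.no p  | Relation.Nullary.yes q = Data.Empty.⊥-elim (p (sym q))
    where import Data.Empty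

attachPendant : (G : Graph) → Fin (n G) → Graph
attachPendant G v = record
  { n = suc (n G) ; adj = a ; adj-sym = s ; adj-irrefl = ir }
  where
    a : Fin (suc (n G)) → Fin (suc (n G)) → Bool
    a zero    zero    = false
    a zero    (suc j) = eqb j v
    a (suc i) zero    = eqb i v
    a (suc i) (suc j) = adj G i j
    s : ∀ x y → a x y ≡ a y x
    s zero    zero    = refl
    s zero    (suc j) = refl
    s (suc i) zero    = refl
    s (suc i) (suc j) = adj-sym G i j
    ir : ∀ x → a x x ≡ false
    ir zero    = refl
    ir (suc i) = adj-irrefl G i

-- Edge colourings.  A colouring assigns a colour α u v ∈ ℕ to every
-- ordered pair; only the values on adjacent pairs matter.

Coloring : Graph → Set
Coloring G = Fin (n G) → Fin (n G) → ℕ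

Edge : (G : Graph) → Fin (n G) → Fin (n G) → Set
Edge G u v = adj G u v ≡ true

record IsProperColoring (G : Graph) (t : ℕ) (α : Coloring G) : Set where
  field
    symmetric : ∀ u v → Edge G u v → α u v ≡ α v u
    in-range  : ∀ u v → Edge G u v → 1 ≤ α u v × α u v ≤ t
    surjective : ∀ c → 1 ≤ c → c ≤ t → ∃ λ u → ∃ λ v → Edge G u v × α u v ≡ c
    proper    : ∀ v u w → Edge G v u → Edge G v w → u ≢ w → α v u ≢ α v w

spectrum : (G : Graph) → Coloring G → Fin (n G) → List ℕ
spectrum G α v = map (α v) (filter (λ u → T? (adj G v u)) (Data.List.allFin (n G)))
  where import Data.List

listMax : List ℕ → ℕ
listMax = foldr _⊔_ 0

listMin : List ℕ → ℕ
listMin []       = 0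
listMin (x ∷ xs) = foldr _⊓_ x xs

-- def(A): the number of integers strictly between min A and max A that
-- are not in A (def(∅) = 0).
defSet : List ℕ → ℕ
defSet A = length (filter (λ c → ¬? (c ∈? A))
                          (map (λ k → suc (listMin A + k)) (upTo (listMax A ∸ listMin A ∸ 1))))

defV : (G : Graph) → Coloring G → Fin (n G) → ℕ
defV G α v = defSet (spectrum G α v)

defG : (G : Graph) → Coloring G → ℕ
defG G α = sum (map (defV G α) (Data.List.allFin (n G)))
  where import Data.List

IsDef : Graph → ℕ → Set
IsDef G d =
  (∃ λ t → ∃ λ α → IsProperColoring G t α × defG G α ≡ d) ×
  (∀ t α → IsProperColoring G t α → d ≤ defG G α)

IsWdef : (G : Graph) → ℕ → ℕ → Set
IsWdef G d w =
  (∃ λ α → IsProperColoring G w α × defG G α ≡ d) ×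
  (∀ t α → IsProperColoring G t α → defG G α ≡ d → t ≤ w)

IsIntervalColoring : (G : Graph) → ℕ → Coloring G → Set
IsIntervalColoring G t α = IsProperColoring G t α × (∀ v → defV G α v ≡ 0)

-- w = W(G): the largest t such that G has an interval t-colouring
-- (in particular G ∈ 𝔑).
IsW : Graph → ℕ → Set
IsW G w =
  (∃ λ α → IsIntervalColoring G w α) ×
  (∀ t α → IsIntervalColoring G t α → t ≤ w)

-- Attach a pendant edge at a vertex v and give it a colour c that lies strictly between
-- the smallest and largest colour at v but is missing there. The colouring stays proper
-- with the same colours, every other spectrum is unchanged, the new leaf sees a single
-- colour, and def(v) drops by one. Doing this def(G) times to a colouring that attains
-- W_def(G) yields an interval W_def(G)-colouring of a graph G′ ∈ 𝒞 with |V(G)| + def(G)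
-- vertices, so W_def(G) ≤ W(G′) ≤ f(|V(G)| + def(G)). W(G′) exists constructively since
-- t-colourings can be searched exhaustively and t ≤ |V(G′)|².

module Submission where

open import Defs
open import Data.Nat
  using (ℕ; zero; suc; _+_; _*_; _^_; _∸_; _≤_; _<_; _⊓_; z≤n; s≤s; s≤s⁻¹; z<s)
open import Data.Nat.Properties
open import Data.Nat.ListAction using (sum)
open import Algebra.Properties.CommutativeSemigroup ⊓-commutativeSemigroup using (x∙yz≈y∙xz)
open import Data.Bool using (true; T)
open import Data.Bool.Properties using (T-≡) renaming (_≟_ to _≟ᵇ_)
open import Data.Fin using (Fin; zero; suc; toℕ; fromℕ<; combine; remQuot; finToFun; funToFin)
open import Data.Fin.Properties
  using (any?; all?; pigeonhole; combine-injective; remQuot-combine; finToFun-funToFin; toℕ-fromℕ<; toℕ<n)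
import Data.Fin.Properties as Fin
open import Data.List using (List; []; _∷_; map; filter; length; foldr; upTo; tabulate; allFin)
open import Data.List.Properties
  using (filter-accept; filter-reject; map-tabulate; map-∘; tabulate-cong; map-cong-local)
open import Data.List.Membership.Propositional using (_∈_; _∉_)
open import Data.List.Membership.Propositional.Properties
  using (∈-map⁺; ∈-map⁻; ∈-filter⁺; ∈-allFin; ∈-upTo⁺; ∈-upTo⁻)
open import Data.List.Membership.DecPropositional _≟_ using (_∈?_)
open import Data.List.Relation.Unary.Any using (here; there)
open import Data.List.Relation.Unary.All as All using (All; []; _∷_)
open import Data.List.Relation.Unary.All.Properties using (all-filter) renaming (map⁺ to All-map⁺)
open import Data.List.Relation.Unary.Unique.Propositional using (Unique; _∷_)
import Data.List.Relation.Unary.Unique.Propositional.Properties as Unique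
open import Data.Product using (∃; _×_; _,_; proj₁; proj₂; uncurry)
open import Data.Sum using (inj₁; inj₂)
open import Function using (_∘_; id)
open import Function.Bundles using (Equivalence)
open import Relation.Nullary using (¬_; Dec; yes; no; ¬?; contradiction)
open import Relation.Nullary.Decidable
  using (T?; toWitness; isYes≗does; dec-true; map′; _×-dec_; _→-dec_)
open import Relation.Unary using (Decidable)
open import Relation.Binary.PropositionalEquality
open import Relation.Binary.Bundles using (Preorder)

filter-map : ∀ {A B : Set} {P : B → Set} (P? : Decidable P) (f : A → B) xs →
  filter P? (map f xs) ≡ map f (filter (P? ∘ f) xs)
filter-map P? f [] = refl
filter-map P? f (x ∷ xs) with P? (f x)
... | yes _ = cong (f x ∷_) (filter-map P? f xs)
... | no _  = filter-map P? f xs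

module _ {A : Set} {P : A → Set} (P? : Decidable P) where

  filter-nonempty⇒∃ : ∀ xs → 0 < length (filter P? xs) → ∃ λ x → x ∈ xs × P x
  filter-nonempty⇒∃ (x ∷ xs) pos with P? x
  ... | yes px = x , here refl , px
  ... | no _ with filter-nonempty⇒∃ xs pos
  ...   | y , y∈xs , py = y , there y∈xs , py

module _ {A : Set} {P Q : A → Set} (P? : Decidable P) (Q? : Decidable Q) where

  filter-cong-local : ∀ {xs} → All (λ x → (P x → Q x) × (Q x → P x)) xs → filter P? xs ≡ filter Q? xs
  filter-cong-local [] = refl
  filter-cong-local {x ∷ xs} ((P⇒Q , Q⇒P) ∷ rest) with P? x | Q? x
  ... | yes _  | yes _  = cong (x ∷_) (filter-cong-local rest)
  ... | no _   | no _   = filter-cong-local rest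
  ... | yes px | no ¬qx = contradiction (P⇒Q px) ¬qx
  ... | no ¬px | yes qx = contradiction (Q⇒P qx) ¬px

  length-filter-remove : ∀ {c} → (∀ {x} → Q x → P x) → (∀ {x} → x ≢ c → P x → Q x) →
    P c → ¬ Q c → ∀ {xs} → c ∈ xs → Unique xs → length (filter P? xs) ≡ suc (length (filter Q? xs))
  length-filter-remove {c} Q⇒P P⇒Q pc ¬qc {x ∷ xs} c∈ (x≢xs ∷ uniq) with P? x | Q? x | c∈
  ... | _      | yes qx | here refl = contradiction qx ¬qc
  ... | no ¬px | _      | here refl = contradiction pc ¬px
  ... | yes _  | no _   | here refl = cong suc (cong length (filter-cong-local (All.map agree x≢xs)))
    where
    agree : ∀ {y} → c ≢ y → (P y → Q y) × (Q y → P y)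
    agree c≢y = P⇒Q (c≢y ∘ sym) , Q⇒P
  ... | yes _  | yes _  | there c∈xs = cong suc (length-filter-remove Q⇒P P⇒Q pc ¬qc c∈xs uniq)
  ... | no _   | no _   | there c∈xs = length-filter-remove Q⇒P P⇒Q pc ¬qc c∈xs uniq
  ... | yes px | no ¬qx | there c∈xs = contradiction (P⇒Q (All.lookup x≢xs c∈xs) px) ¬qx
  ... | no ¬px | yes qx | there _    = contradiction (Q⇒P qx) ¬px

notIn? : (A : List ℕ) → Decidable (_∉ A)
notIn? A c = ¬? (c ∈? A)

∉-∷ : ∀ {x c : ℕ} {A} → x ≢ c → x ∉ A → x ∉ c ∷ A
∉-∷ x≢c x∉A (here x≡c)  = x≢c x≡c
∉-∷ x≢c x∉A (there x∈A) = x∉A x∈A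

between : ℕ → ℕ → List ℕ
between m M = map (λ k → suc (m + k)) (upTo (M ∸ m ∸ 1))

k<M∸m∸1⇒1+m+k<M : ∀ m M k → k < M ∸ m ∸ 1 → suc (m + k) < M
k<M∸m∸1⇒1+m+k<M zero    (suc M) k lt = s≤s lt
k<M∸m∸1⇒1+m+k<M (suc m) (suc M) k lt = s≤s (k<M∸m∸1⇒1+m+k<M m M k lt)

1+m+k<M⇒k<M∸m∸1 : ∀ m M k → suc (m + k) < M → k < M ∸ m ∸ 1
1+m+k<M⇒k<M∸m∸1 zero    (suc M) k (s≤s lt) = lt
1+m+k<M⇒k<M∸m∸1 (suc m) (suc M) k (s≤s lt) = 1+m+k<M⇒k<M∸m∸1 m M k lt

∈-between⁻ : ∀ {m M x} → x ∈ between m M → m < x × x < M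
∈-between⁻ {m} {M} x∈ with ∈-map⁻ _ x∈
... | k , k∈ , refl = s≤s (m≤m+n m k) , k<M∸m∸1⇒1+m+k<M m M k (∈-upTo⁻ k∈)

∈-between⁺ : ∀ {m M x} → m < x → x < M → x ∈ between m M
∈-between⁺ {m} {M} {x} m<x x<M = subst (_∈ between m M) (m+[n∸m]≡n m<x)
  (∈-map⁺ _ (∈-upTo⁺ (1+m+k<M⇒k<M∸m∸1 m M _ (subst (_< M) (sym (m+[n∸m]≡n m<x)) x<M))))

between-unique : ∀ m M → Unique (between m M)
between-unique m M = Unique.map⁺ (λ eq → +-cancelˡ-≡ m _ _ (suc-injective eq)) (Unique.upTo⁺ _)

between-≤ : ∀ {m M} → M ≤ m → between m M ≡ []
between-≤ {m} M≤m = cong (λ r → map (λ k → suc (m + k)) (upTo (r ∸ 1))) (m≤n⇒m∸n≡0 M≤m)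

foldr-⊓-swap : ∀ a b xs → b ⊓ foldr _⊓_ a xs ≡ a ⊓ foldr _⊓_ b xs
foldr-⊓-swap a b []       = ⊓-comm b a
foldr-⊓-swap a b (y ∷ ys) = begin
  b ⊓ (y ⊓ foldr _⊓_ a ys) ≡⟨ x∙yz≈y∙xz b y _ ⟩
  y ⊓ (b ⊓ foldr _⊓_ a ys) ≡⟨ cong (y ⊓_) (foldr-⊓-swap a b ys) ⟩
  y ⊓ (a ⊓ foldr _⊓_ b ys) ≡⟨ x∙yz≈y∙xz y a _ ⟩
  a ⊓ (y ⊓ foldr _⊓_ b ys) ∎
  where open ≡-Reasoning

IsGap : List ℕ → ℕ → Set
IsGap A c = listMin A < c × c < listMax A × c ∉ A

defSet-pos⇒gap : ∀ A → 0 < defSet A → ∃ (IsGap A)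
defSet-pos⇒gap A pos with filter-nonempty⇒∃ (notIn? A) (between (listMin A) (listMax A)) pos
... | c , c∈ , c∉A with ∈-between⁻ c∈
...   | min<c , c<max = c , min<c , c<max , c∉A

-- Filling a gap changes neither the minimum nor the maximum of the spectrum.
defSet-fillGap : ∀ A {c} → IsGap A c → defSet A ≡ suc (defSet (c ∷ A))
defSet-fillGap []       (_ , () , _)
defSet-fillGap (x ∷ xs) {c} (min<c , c<max , c∉A) = begin
  length (filter (notIn? A) (between (listMin A) (listMax A)))
    ≡⟨ length-filter-remove (notIn? A) (notIn? (c ∷ A)) (λ c∉ c∈ → c∉ (there c∈)) ∉-∷ c∉A
         (λ c∉ → c∉ (here refl)) (∈-between⁺ min<c c<max) (between-unique _ _) ⟩
  suc (length (filter (notIn? (c ∷ A)) (between (listMin A) (listMax A))))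
    ≡⟨ cong (λ L → suc (length (filter (notIn? (c ∷ A)) L))) (sym (cong₂ between min-eq max-eq)) ⟩
  suc (defSet (c ∷ A)) ∎
  where
  open ≡-Reasoning
  A = x ∷ xs
  min-eq : listMin (c ∷ A) ≡ listMin A
  min-eq = trans (foldr-⊓-swap c x xs) (m≥n⇒m⊓n≡n (<⇒≤ min<c))
  max-eq : listMax (c ∷ A) ≡ listMax A
  max-eq = m≤n⇒m⊔n≡n (<⇒≤ c<max)

defSet-map-const : ∀ {B : Set} c (xs : List B) → defSet (map (λ _ → c) xs) ≡ 0
defSet-map-const c []       = refl
defSet-map-const c (x ∷ xs) =
  cong (length ∘ filter (notIn? cs)) (between-≤ (subst (listMax cs ≤_) (sym (min≡c xs)) (max≤c (x ∷ xs))))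
  where
  cs = map (λ _ → c) (x ∷ xs)
  max≤c : ∀ {B : Set} (ys : List B) → listMax (map (λ _ → c) ys) ≤ c
  max≤c []       = z≤n
  max≤c (_ ∷ ys) = ⊔-lub ≤-refl (max≤c ys)
  min≡c : ∀ {B : Set} (ys : List B) → foldr _⊓_ c (map (λ _ → c) ys) ≡ c
  min≡c []       = refl
  min≡c (_ ∷ ys) = trans (cong (c ⊓_) (min≡c ys)) (⊓-idem c)

∈-spectrum : ∀ G (α : Coloring G) {v u} → Edge G v u → α v u ∈ spectrum G α v
∈-spectrum G α {v} e =
  ∈-map⁺ (α v) (∈-filter⁺ (λ u → T? (adj G v u)) (∈-allFin _) (Equivalence.from T-≡ e))

All-neighbours : ∀ G v {P : Fin (n G) → Set} → (∀ u → Edge G v u → P u) →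
  All P (filter (λ u → T? (adj G v u)) (allFin (n G)))
All-neighbours G v h = All.map (λ {u} t → h u (Equivalence.to T-≡ t)) (all-filter _ (allFin (n G)))

All-spectrum : ∀ G (α : Coloring G) v {P : ℕ → Set} → (∀ u → Edge G v u → P (α v u)) →
  All P (spectrum G α v)
All-spectrum G α v h = All-map⁺ (All-neighbours G v h)

spectrum-cong : ∀ G {α β : Coloring G} v → (∀ u → Edge G v u → α v u ≡ β v u) →
  spectrum G α v ≡ spectrum G β v
spectrum-cong G v h = map-cong-local (All-neighbours G v h)

listMax-≤ : ∀ {t xs} → All (_≤ t) xs → listMax xs ≤ t
listMax-≤ []         = z≤n
listMax-≤ (x≤t ∷ xs≤t) = ⊔-lub x≤t (listMax-≤ xs≤t)

pendantColoring : (G : Graph) (v : Fin (n G)) → Coloring G → ℕ → Coloring (attachPendant G v)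
pendantColoring G v α c zero    _       = c
pendantColoring G v α c (suc i) zero    = c
pendantColoring G v α c (suc i) (suc j) = α i j

attachPendant-edge⁻ : ∀ G {v u} → Edge (attachPendant G v) (suc u) zero → u ≡ v
attachPendant-edge⁻ G e = toWitness (Equivalence.from T-≡ e)

attachPendant-edge⁺ : ∀ G v → Edge (attachPendant G v) (suc v) zero
attachPendant-edge⁺ G v = trans (isYes≗does (v Fin.≟ v)) (dec-true (v Fin.≟ v) refl)

module _ (G : Graph) (v : Fin (n G)) (α : Coloring G) (c : ℕ) where

  private
    G⁺ = attachPendant G v
    α⁺ = pendantColoring G v α c
    edge? : ∀ u → Decidable (λ w → T (adj G⁺ u w))
    edge? u w = T? (adj G⁺ u w)

  spectrum-pendant-tail : ∀ u → map (α⁺ (suc u)) (filter (edge? (suc u)) (tabulate suc)) ≡ spectrum G α u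
  spectrum-pendant-tail u = begin
    map (α⁺ (suc u)) (filter (edge? (suc u)) (tabulate suc))
      ≡⟨ cong (map (α⁺ (suc u)) ∘ filter (edge? (suc u))) (sym (map-tabulate id suc)) ⟩
    map (α⁺ (suc u)) (filter (edge? (suc u)) (map suc (allFin (n G))))
      ≡⟨ cong (map (α⁺ (suc u))) (filter-map (edge? (suc u)) suc (allFin (n G))) ⟩
    map (α⁺ (suc u)) (map suc (filter (edge? (suc u) ∘ suc) (allFin (n G))))
      ≡⟨ sym (map-∘ _) ⟩
    spectrum G α u ∎
    where open ≡-Reasoning

  spectrum-pendant-other : ∀ u → u ≢ v → spectrum G⁺ α⁺ (suc u) ≡ spectrum G α u
  spectrum-pendant-other u u≢v = trans
    (cong (map (α⁺ (suc u))) (filter-reject (edge? (suc u)) {zero} {tabulate suc}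
      (u≢v ∘ attachPendant-edge⁻ G ∘ Equivalence.to T-≡)))
    (spectrum-pendant-tail u)

  spectrum-pendant-attached : spectrum G⁺ α⁺ (suc v) ≡ c ∷ spectrum G α v
  spectrum-pendant-attached = trans
    (cong (map (α⁺ (suc v))) (filter-accept (edge? (suc v)) {zero} {tabulate suc}
      (Equivalence.from T-≡ (attachPendant-edge⁺ G v))))
    (cong (c ∷_) (spectrum-pendant-tail v))

  defV-pendant-new : defV G⁺ α⁺ zero ≡ 0
  defV-pendant-new = defSet-map-const c (filter (edge? zero) (allFin (n G⁺)))

pendantColoring-proper : ∀ G {v α c t} → IsProperColoring G t α → c ∉ spectrum G α v → 1 ≤ c → c ≤ t →
  IsProperColoring (attachPendant G v) t (pendantColoring G v α c)
pendantColoring-proper G {v} {α} {c} {t} P c∉ 1≤c c≤t = record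
  { symmetric = symmetric ; in-range = in-range ; surjective = surjective ; proper = proper }
  where
  module P = IsProperColoring P
  G⁺ = attachPendant G v
  α⁺ = pendantColoring G v α c
  attached : ∀ {u} → Edge G⁺ (suc u) zero → u ≡ v
  attached = attachPendant-edge⁻ G
  symmetric : ∀ x y → Edge G⁺ x y → α⁺ x y ≡ α⁺ y x
  symmetric zero    (suc j) _ = refl
  symmetric (suc i) zero    _ = refl
  symmetric (suc i) (suc j) e = P.symmetric i j e
  in-range : ∀ x y → Edge G⁺ x y → 1 ≤ α⁺ x y × α⁺ x y ≤ t
  in-range zero    _       _ = 1≤c , c≤t
  in-range (suc i) zero    _ = 1≤c , c≤t
  in-range (suc i) (suc j) e = P.in-range i j e
  surjective : ∀ c′ → 1 ≤ c′ → c′ ≤ t → ∃ λ x → ∃ λ y → Edge G⁺ x y × α⁺ x y ≡ c′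
  surjective c′ 1≤c′ c′≤t with P.surjective c′ 1≤c′ c′≤t
  ... | u , w , e , eq = suc u , suc w , e , eq
  pendant≢old : ∀ {i j} → Edge G⁺ (suc i) zero → Edge G i j → c ≢ α i j
  pendant≢old e e′ eq with attached e
  ... | refl = c∉ (subst (_∈ spectrum G α v) (sym eq) (∈-spectrum G α e′))
  -- Edge G⁺ zero (suc j) and Edge G⁺ (suc j) zero are the same type, so attached applies to both.
  proper : ∀ x y z → Edge G⁺ x y → Edge G⁺ x z → y ≢ z → α⁺ x y ≢ α⁺ x z
  proper zero    (suc j) (suc k) e e′ j≢k _ = j≢k (cong suc (trans (attached e) (sym (attached e′))))
  proper (suc i) zero    zero    _ _ y≢z _  = y≢z refl
  proper (suc i) zero    (suc k) e e′ _     = pendant≢old e e′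
  proper (suc i) (suc j) zero    e e′ _ eq  = pendant≢old e′ e (sym eq)
  proper (suc i) (suc j) (suc k) e e′ j≢k   = P.proper i j k e e′ (j≢k ∘ cong suc)

sum-tabulate-≡0 : ∀ {m} (f : Fin m → ℕ) → sum (tabulate f) ≡ 0 → ∀ i → f i ≡ 0
sum-tabulate-≡0 f eq zero    = m+n≡0⇒m≡0 (f zero) eq
sum-tabulate-≡0 f eq (suc i) = sum-tabulate-≡0 (f ∘ suc) (m+n≡0⇒n≡0 (f zero) eq) i

sum-tabulate-pos : ∀ {m} (f : Fin m → ℕ) → 0 < sum (tabulate f) → ∃ λ i → 0 < f i
sum-tabulate-pos {suc m} f pos with f zero in eq
... | suc _ = zero , subst (0 <_) (sym eq) z<s
... | zero with sum-tabulate-pos (f ∘ suc) pos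
...   | i , 0<fi = suc i , 0<fi

sum-tabulate-update : ∀ {m} (f g : Fin m → ℕ) i → (∀ j → j ≢ i → f j ≡ g j) → g i ≡ suc (f i) →
  sum (tabulate g) ≡ suc (sum (tabulate f))
sum-tabulate-update f g zero    same gi = cong₂ _+_ gi (cong sum (tabulate-cong (λ j → sym (same (suc j) λ ()))))
sum-tabulate-update f g (suc i) same gi = begin
  g zero + sum (tabulate (g ∘ suc))       ≡⟨ cong₂ _+_ (sym (same zero λ ())) tail ⟩
  f zero + suc (sum (tabulate (f ∘ suc))) ≡⟨ +-suc (f zero) _ ⟩
  suc (sum (tabulate f))                  ∎
  where
  open ≡-Reasoning
  tail = sum-tabulate-update (f ∘ suc) (g ∘ suc) i (λ j j≢i → same (suc j) (j≢i ∘ Fin.suc-injective)) gi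

defG-tabulate : ∀ G (α : Coloring G) → defG G α ≡ sum (tabulate (defV G α))
defG-tabulate G α = cong sum (map-tabulate id (defV G α))

spectrum-≤ : ∀ G {t α} → IsProperColoring G t α → ∀ v → listMax (spectrum G α v) ≤ t
spectrum-≤ G {α = α} P v = listMax-≤ (All-spectrum G α v (λ u e → proj₂ (IsProperColoring.in-range P v u e)))

PendantGapFilling : ∀ G → ℕ → Coloring G → Set
PendantGapFilling G t α =
  ∃ λ v → ∃ λ α⁺ → IsProperColoring (attachPendant G v) t α⁺ × defG G α ≡ suc (defG (attachPendant G v) α⁺)

fillGap : ∀ G {t α} → IsProperColoring G t α → 0 < defG G α → PendantGapFilling G t α
fillGap G {t} {α} P pos with sum-tabulate-pos (defV G α) (subst (0 <_) (defG-tabulate G α) pos)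
... | v , 0<defV with defSet-pos⇒gap (spectrum G α v) 0<defV
...   | c , gap@(min<c , c<max , c∉) = v , α⁺ , P⁺ , defG-drop
  where
  α⁺ = pendantColoring G v α c
  G⁺ = attachPendant G v
  P⁺ : IsProperColoring G⁺ t α⁺
  P⁺ = pendantColoring-proper G P c∉ (≤-trans z<s min<c) (<⇒≤ (<-≤-trans c<max (spectrum-≤ G P v)))
  defG-drop : defG G α ≡ suc (defG G⁺ α⁺)
  defG-drop = begin
    defG G α                                    ≡⟨ defG-tabulate G α ⟩
    sum (tabulate (defV G α))                   ≡⟨ sum-tabulate-update _ _ v others attached ⟩
    suc rest                                    ≡⟨ cong (λ d → suc (d + rest)) (sym (defV-pendant-new G v α c)) ⟩
    suc (sum (tabulate (defV G⁺ α⁺)))           ≡⟨ cong suc (sym (defG-tabulate G⁺ α⁺)) ⟩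
    suc (defG G⁺ α⁺)                            ∎
    where
    open ≡-Reasoning
    rest = sum (tabulate (defV G⁺ α⁺ ∘ suc))
    others : ∀ u → u ≢ v → defV G⁺ α⁺ (suc u) ≡ defV G α u
    others u u≢v = cong defSet (spectrum-pendant-other G v α c u u≢v)
    attached : defV G α v ≡ suc (defV G⁺ α⁺ (suc v))
    attached = trans (defSet-fillGap _ gap) (cong (suc ∘ defSet) (sym (spectrum-pendant-attached G v α c)))

module _ (𝒞 : Graph → Set) (closed : ∀ G (v : Fin (n G)) → 𝒞 G → 𝒞 (attachPendant G v)) where

  fillGaps : ∀ k G {t α} → 𝒞 G → IsProperColoring G t α → defG G α ≡ k →
    ∃ λ G′ → 𝒞 G′ × ∣V∣ G′ ≡ ∣V∣ G + k × ∃ (IsIntervalColoring G′ t)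
  fillGaps zero G {α = α} 𝒞G P def≡0 =
    G , 𝒞G , sym (+-identityʳ (n G)) , α , P ,
    sum-tabulate-≡0 (defV G α) (trans (sym (defG-tabulate G α)) def≡0)
  fillGaps (suc k) G {t} {α} 𝒞G P def≡1+k = extend (fillGap G P (subst (0 <_) (sym def≡1+k) z<s))
    where
    extend : PendantGapFilling G t α →
      ∃ λ G′ → 𝒞 G′ × ∣V∣ G′ ≡ ∣V∣ G + suc k × ∃ (IsIntervalColoring G′ t)
    extend (v , α⁺ , P⁺ , def-drop)
      with fillGaps k (attachPendant G v) (closed G v 𝒞G) P⁺ (suc-injective (trans (sym def-drop) def≡1+k))
    ... | G′ , 𝒞G′ , size , interval = G′ , 𝒞G′ , trans size (sym (+-suc (n G) k)) , interval

edge? : ∀ G → (u v : Fin (n G)) → Dec (Edge G u v)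
edge? G u v = adj G u v ≟ᵇ true

isProperColoring? : ∀ G t (α : Coloring G) → Dec (IsProperColoring G t α)
isProperColoring? G t α =
  map′ (λ (s , r , c , p) → record { symmetric = s ; in-range = r ; surjective = c ; proper = p })
       (λ P → let open IsProperColoring P in symmetric , in-range , surjective , proper)
    (symmetric? ×-dec in-range? ×-dec surjective? ×-dec proper?)
  where
  symmetric? = all? λ u → all? λ v → edge? G u v →-dec α u v ≟ α v u
  in-range?  = all? λ u → all? λ v → edge? G u v →-dec (1 ≤? α u v ×-dec α u v ≤? t)
  proper?    = all? λ v → all? λ u → all? λ w →
    edge? G v u →-dec (edge? G v w →-dec (¬? (u Fin.≟ w) →-dec ¬? (α v u ≟ α v w)))
  surjective? = map′ (λ h c 1≤c c≤t → h (s≤s c≤t) 1≤c) (λ h {c} c<1+t 1≤c → h c 1≤c (s≤s⁻¹ c<1+t))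
    (allUpTo? (λ c → 1 ≤? c →-dec any? λ u → any? λ v → edge? G u v ×-dec α u v ≟ c) (suc t))

isIntervalColoring? : ∀ G t (α : Coloring G) → Dec (IsIntervalColoring G t α)
isIntervalColoring? G t α = isProperColoring? G t α ×-dec all? (λ v → defV G α v ≟ 0)

IsIntervalColoring-cong : ∀ G {t} {α β : Coloring G} → (∀ u v → Edge G u v → α u v ≡ β u v) →
  IsIntervalColoring G t α → IsIntervalColoring G t β
IsIntervalColoring-cong G {t} {α} {β} α≈β (P , gapless) =
  P′ , λ v → trans (cong defSet (sym (spectrum-cong G {α} {β} v (α≈β v)))) (gapless v)
  where
  module P = IsProperColoring P
  P′ : IsProperColoring G t β
  P′ = record
    { symmetric  = λ u v e →
        trans (sym (α≈β u v e)) (trans (P.symmetric u v e) (α≈β v u (trans (adj-sym G v u) e)))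
    ; in-range   = λ u v e → subst (λ x → 1 ≤ x × x ≤ t) (α≈β u v e) (P.in-range u v e)
    ; surjective = λ c 1≤c c≤t →
        let (u , v , e , αuv≡c) = P.surjective c 1≤c c≤t in u , v , e , trans (sym (α≈β u v e)) αuv≡c
    ; proper     = λ v u w e e′ u≢w eq →
        P.proper v u w e e′ u≢w (trans (α≈β v u e) (trans eq (sym (α≈β v w e′))))
    }

-- Colourings with values in {0,…,t} are coded by Fin ((1+t)^(n·n)), one digit per ordered pair of vertices.
decodeColoring : ∀ G t → Fin (suc t ^ (n G * n G)) → Coloring G
decodeColoring G t k u v = toℕ (finToFun k (combine u v))

intervalColoring? : ∀ G t → Dec (∃ (IsIntervalColoring G t))
intervalColoring? G t with any? (λ k → isIntervalColoring? G t (decodeColoring G t k))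
... | yes (k , I) = yes (decodeColoring G t k , I)
... | no ¬I = no λ (α , I) → ¬I (encode α , IsIntervalColoring-cong G (λ u v e → sym (decode-encode α I u v e)) I)
  where
  truncate : Coloring G → Fin (n G) → Fin (n G) → Fin (suc t)
  truncate α u v = fromℕ< (s≤s (m⊓n≤n (α u v) t))
  encode : Coloring G → Fin (suc t ^ (n G * n G))
  encode α = funToFin (uncurry (truncate α) ∘ remQuot (n G))
  decode-encode : ∀ α → IsIntervalColoring G t α → ∀ u v → Edge G u v →
    decodeColoring G t (encode α) u v ≡ α u v
  decode-encode α (P , _) u v e = begin
    toℕ (finToFun (encode α) (combine u v))                 ≡⟨ cong toℕ (finToFun-funToFin _ (combine u v)) ⟩
    toℕ (uncurry (truncate α) (remQuot (n G) (combine u v))) ≡⟨ cong (toℕ ∘ uncurry (truncate α)) (remQuot-combine u v) ⟩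
    toℕ (truncate α u v)                                    ≡⟨ toℕ-fromℕ< _ ⟩
    α u v ⊓ t                                               ≡⟨ m≤n⇒m⊓n≡m (proj₂ (IsProperColoring.in-range P u v e)) ⟩
    α u v                                                   ∎
    where open ≡-Reasoning

-- Distinct colours are carried by distinct edges, so pigeonhole on the ordered pairs of vertices bounds t.
colours≤n² : ∀ G {t α} → IsProperColoring G t α → t ≤ n G * n G
colours≤n² G {t} {α} P = ≮⇒≥ λ n²<t →
  let (i , j , i<j , same-pair) = pigeonhole n²<t (λ i → combine (source i) (target i))
      (source≡ , target≡) = combine-injective (source i) (target i) (source j) (target j) same-pair
  in <⇒≢ i<j (suc-injective (begin
       suc (toℕ i)               ≡⟨ sym (colour i) ⟩
       α (source i) (target i)   ≡⟨ cong₂ α source≡ target≡ ⟩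
       α (source j) (target j)   ≡⟨ colour j ⟩
       suc (toℕ j)               ∎))
  where
  open ≡-Reasoning
  edgeOfColour : (i : Fin t) → ∃ λ u → ∃ λ v → Edge G u v × α u v ≡ suc (toℕ i)
  edgeOfColour i = IsProperColoring.surjective P (suc (toℕ i)) (s≤s z≤n) (toℕ<n i)
  source target : Fin t → Fin (n G)
  source i = proj₁ (edgeOfColour i)
  target i = proj₁ (proj₂ (edgeOfColour i))
  colour : ∀ i → α (source i) (target i) ≡ suc (toℕ i)
  colour i = proj₂ (proj₂ (proj₂ (edgeOfColour i)))

bounded-maximum : ∀ {P : ℕ → Set} → Decidable P → ∀ B → (∀ {m} → P m → m ≤ B) → ∀ {m} → P m →
  ∃ λ w → P w × (∀ {k} → P k → k ≤ w)
bounded-maximum P? B bounded Pm with P? B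
... | yes PB = B , PB , bounded
bounded-maximum P? zero    bounded Pm | no ¬PB with bounded Pm
... | z≤n = contradiction Pm ¬PB
bounded-maximum P? (suc B) bounded Pm | no ¬PB = bounded-maximum P? B (λ Pk → below (bounded Pk) Pk) Pm
  where
  below : ∀ {k} → k ≤ suc B → _ → k ≤ B
  below k≤1+B Pk with m≤n⇒m<n∨m≡n k≤1+B
  ... | inj₁ k<1+B = s≤s⁻¹ k<1+B
  ... | inj₂ refl  = contradiction Pk ¬PB

W-exists : ∀ G {t} → ∃ (IsIntervalColoring G t) → ∃ λ w → IsW G w × t ≤ w
W-exists G I =
  let (w , Iw , maximal) = bounded-maximum (intervalColoring? G) (n G * n G) (λ (α , I) → colours≤n² G (proj₁ I)) I
  in w , (Iw , λ t α I → maximal (α , I)) , maximal I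

theorem2p1 : ∀ {c ℓ₁ ℓ₂} (R : Preorder c ℓ₁ ℓ₂)
    (ι : ℕ → Preorder.Carrier R)
    (ι-mono : ∀ {m k} → m ≤ k → Preorder._≲_ R (ι m) (ι k))
    (f : ℕ → Preorder.Carrier R)
    (𝒞 : Graph → Set)
    (closed : ∀ G (v : Fin (n G)) → 𝒞 G → 𝒞 (attachPendant G v)) →
    (∀ G′ w → 𝒞 G′ → IsW G′ w → Preorder._≲_ R (ι w) (f (∣V∣ G′))) →
    ∀ G d w → 𝒞 G → IsDef G d → IsWdef G d w →
    Preorder._≲_ R (ι w) (f (∣V∣ G + d))
theorem2p1 R ι ι-mono f 𝒞 closed W-bound G d w 𝒞G _ ((α , P , defα≡d) , _) =
  let (G′ , 𝒞G′ , size , interval) = fillGaps 𝒞 closed d G 𝒞G P defα≡d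
      (W , isW , w≤W) = W-exists G′ interval
  in ≲-trans (ι-mono w≤W) (subst (λ m → ι W ≲ f m) size (W-bound G′ W 𝒞G′ isW))
  where open Preorder R using (_≲_) renaming (trans to ≲-trans)
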